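{- For every integer $i\geq 0$ and every factor $u$ of the Cantor sequence $\mathbf c$, let \[\Delta_{i}:=|u|_{0^{3^i+2}}+|u|_{10^{3^i}1}-|u|_{0^{3^i+1}}+1.\] Then $\Delta_{i}\in\{0,1,2\}$, and \[\Delta_{i}\equiv \begin{cases} |u|_{0^{3^{i}}1}+\frac{2}{3^i}|u|_{0^{3^i+1}} +1-P(0^{3^i}1,u) \pmod 3, & \text{if } P(0^{3^i+1},u)=S(0^{3^i+1},u)=0, \\ |u|_{0^{3^i}1}+1-S(0^{3^i+1},u)-P(0^{3^i}1,u) \pmod 2, & \text{otherwise}. \end{cases}\]
   Context: The Cantor sequence $\mathbf{c}=c_0c_1c_2\cdots\in\{0,1\}^{\mathbb N}$ is defined by $c_0=1$ and $c_{3n}=c_{3n+2}=c_n$, $c_{3n+1}=0$ for all $n\geq 0$. A factor of $\mathbf c$ is a finite word $c_i\cdots c_{i+m-1}$. $0^m$ denotes the word of $m$ zeros; $|u|_w$ is the number of occurrences of $w$ as a factor of $u$. For words $z,w$: $P(z,w)=1$ if $z$ is a prefix of $w$ and $0$ otherwise; $S(z,w)=1$ if $z$ is a suffix of $w$ and $0$ otherwise. -}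

module Defs where

open import Data.Bool using (Bool; true; false; _∧_; if_then_else_)
open import Data.Nat using (ℕ; zero; suc; _+_; _^_)
open import Data.Nat.DivMod using (_/_; _%_)
open import Data.List using (List; []; _∷_; _++_; replicate; reverse; length; tabulate; [_])
open import Data.Fin using (toℕ)
open import Data.Product using (∃)
open import Relation.Binary.PropositionalEquality using (_≡_)

-- Letters: false = 0, true = 1.  Words are lists of letters.

-- Cantor sequence: c 0 = 1, c (3n) = c (3n+2) = c n, c (3n+1) = 0.
-- Implemented by recursion with fuel (fuel n suffices, since n / 3 < n for n > 0).
cantorAux : ℕ → ℕ → Bool
cantorAux zero    _       = true
cantorAux (suc f) zero    = true
cantorAux (suc f) (suc n) with (suc n) % 3
... | 1 = false
... | _ = cantorAux f (suc n / 3)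

cantor : ℕ → Bool
cantor n = cantorAux n n

window : ℕ → ℕ → List Bool
window i m = tabulate {n = m} (λ k → cantor (i + toℕ k))

IsFactor : List Bool → Set
IsFactor u = ∃ λ i → u ≡ window i (length u)

zeros : ℕ → List Bool
zeros m = replicate m false

eqB : Bool → Bool → Bool
eqB true  true  = true
eqB false false = true
eqB _     _     = false

isPrefix : List Bool → List Bool → Bool
isPrefix []      _        = true
isPrefix (_ ∷ _) []       = false
isPrefix (a ∷ z) (b ∷ w)  = eqB a b ∧ isPrefix z w

-- |u|_w : number of occurrences of w as a factor of u (for nonempty w)
occ : List Bool → List Bool → ℕ
occ w []        = 0
occ w (a ∷ u)   = (if isPrefix w (a ∷ u) then 1 else 0) + occ w u

P : List Bool → List Bool → ℕ
P z w = if isPrefix z w then 1 else 0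

S : List Bool → List Bool → ℕ
S z w = if isPrefix (reverse z) (reverse w) then 1 else 0

-- The 1s of c sit at the positions pos b, where the binary counter b runs
-- through all values (read in base 3, with digit 2 for a set bit), and the gap
-- after pos b has 3^k zeros, k the number of trailing ones of b.  Hence every
-- factor is a run word 0^r 1 0^r₁ 1 ⋯ 1 0^rₖ whose inner runs are the gaps of
-- consecutive counter values.  All counts of the theorem are statistics of the
-- runs; with L the number of runs longer than t one has N = M + L and
-- a + s = p + T + L.  Incrementing the counter sets bit i at a gap of exactly
-- t zeros and clears it at a longer gap, so the exact inner runs T and the long
-- runs L alternate: |T - L| ≤ 1, i.e. Δ = T - L + 1 ∈ {0,1,2}.  A gap 3^k > t
-- adds t(3^(k-i) - 1) to N and 1 to L, so when both end runs are short,
-- N = tq with 3 ∣ L + q, and the congruences are linear algebra over ℤ.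
module Submission where

open import Defs
open import Data.Bool using (Bool; true; false; T; if_then_else_)
open import Data.List using (List; []; _∷_; _++_; [_])
open import Data.Nat using (ℕ; suc; _^_)
open import Data.Product using (_×_; _,_; ∃)
open import Data.Sum using (_⊎_; inj₁; inj₂)
open import Relation.Binary.PropositionalEquality hiding ([_])

module Runs where

  open import Data.Bool.Properties using (if-eta)
  open import Data.List using (reverse; _∷ʳ_; length)
  open import Data.List.Properties using (tabulate-cong; ++-assoc; ++-identityʳ; reverse-++; unfold-reverse)
  open import Data.List.Relation.Unary.All using (All; []; _∷_)
  open import Data.Fin using (toℕ)
  open import Data.Nat using (zero; _+_; _*_; _∸_; _≤_; _<_; z≤n; s≤s; _<ᵇ_; _≡ᵇ_)
  open import Data.Nat.Properties
  open import Data.Nat.DivMod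
    using (_/_; _%_; m/n<m; m<n⇒m%n≡m; m<n⇒m/n≡0; [m+kn]%n≡m%n; +-distrib-/-∣ʳ; m*n/n≡m;
           m≡m%n+[m/n]*n; m%n<n; m<n*o⇒m/o<n)
  open import Data.Nat.Divisibility using (n∣m*n; _∣0; ∣m∣n⇒∣m+n; m∣m*n) renaming (_∣_ to _∣ₙ_)
  open import Data.Nat.Tactic.RingSolver using (solve-∀)
  open import Data.Empty using (⊥-elim)
  open import Data.Product using (proj₁; proj₂)
  open import Relation.Binary.Definitions using (tri<; tri≈; tri>)

  cantorAux-suc : ∀ f n →
    cantorAux (suc f) (suc n) ≡ (if suc n % 3 ≡ᵇ 1 then false else cantorAux f (suc n / 3))
  cantorAux-suc f n with suc n % 3
  ... | 0           = refl
  ... | 1           = refl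
  ... | suc (suc _) = refl

  cantorAux-zero : ∀ f → cantorAux f 0 ≡ true
  cantorAux-zero zero    = refl
  cantorAux-zero (suc f) = refl

  third≤ : ∀ n → suc n / 3 ≤ n
  third≤ n = ≤-pred (m/n<m (suc n) 3 (s≤s (s≤s z≤n)))

  cantorAux-fuel : ∀ {f g} n → n ≤ f → n ≤ g → cantorAux f n ≡ cantorAux g n
  cantorAux-fuel {f} {g} zero _ _ = trans (cantorAux-zero f) (sym (cantorAux-zero g))
  cantorAux-fuel {suc f} {suc g} (suc n) (s≤s n≤f) (s≤s n≤g) = begin
    cantorAux (suc f) (suc n)                                   ≡⟨ cantorAux-suc f n ⟩
    (if suc n % 3 ≡ᵇ 1 then false else cantorAux f (suc n / 3))
      ≡⟨ cong (if suc n % 3 ≡ᵇ 1 then false else_)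
              (cantorAux-fuel (suc n / 3) (≤-trans (third≤ n) n≤f) (≤-trans (third≤ n) n≤g)) ⟩
    (if suc n % 3 ≡ᵇ 1 then false else cantorAux g (suc n / 3)) ≡⟨ cantorAux-suc g n ⟨
    cantorAux (suc g) (suc n)                                   ∎
    where open ≡-Reasoning

  cantor-rec : ∀ m → cantor m ≡ (if m % 3 ≡ᵇ 1 then false else cantor (m / 3))
  cantor-rec zero    = refl
  cantor-rec (suc m) =
    trans (cantorAux-suc m m)
          (cong (if suc m % 3 ≡ᵇ 1 then false else_) (cantorAux-fuel (suc m / 3) (third≤ m) ≤-refl))

  cantor-digit : ∀ j n → j < 3 → cantor (j + n * 3) ≡ (if j ≡ᵇ 1 then false else cantor n)
  cantor-digit j n j<3 =
    trans (cantor-rec (j + n * 3))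
          (cong₂ (λ d q → if d ≡ᵇ 1 then false else cantor q) last-digit quotient)
    where
    open ≡-Reasoning
    last-digit : (j + n * 3) % 3 ≡ j
    last-digit = trans ([m+kn]%n≡m%n j n 3) (m<n⇒m%n≡m j<3)
    quotient : (j + n * 3) / 3 ≡ n
    quotient = begin
      (j + n * 3) / 3     ≡⟨ +-distrib-/-∣ʳ j (n∣m*n n) ⟩
      j / 3 + n * 3 / 3   ≡⟨ cong₂ _+_ (m<n⇒m/n≡0 j<3) (m*n/n≡m n 3) ⟩
      n                   ∎

  -- A binary counter, least significant bit first, and its successor.
  inc : List Bool → List Bool
  inc []          = true ∷ []
  inc (false ∷ b) = true ∷ b
  inc (true ∷ b)  = false ∷ inc b

  -- The number of trailing ones: incrementing clears exactly these bits.
  trailingOnes : List Bool → ℕ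
  trailingOnes (true ∷ b) = suc (trailingOnes b)
  trailingOnes _          = 0

  bit : ℕ → List Bool → Bool
  bit i       []      = false
  bit zero    (x ∷ _) = x
  bit (suc i) (_ ∷ b) = bit i b

  -- The counter read as a ternary numeral whose digits are 0 and 2.  These are
  -- exactly the positions of the 1s in c, enumerated in increasing order.
  pos : List Bool → ℕ
  pos []          = 0
  pos (false ∷ b) = 0 + pos b * 3
  pos (true ∷ b)  = 2 + pos b * 3

  pos-inc : ∀ b → pos (inc b) ≡ pos b + suc (3 ^ trailingOnes b)
  pos-inc []          = refl
  pos-inc (false ∷ b) = set-digit (pos b)
    where
    set-digit : ∀ x → 2 + x * 3 ≡ (0 + x * 3) + 2
    set-digit = solve-∀
  pos-inc (true ∷ b)  = trans (cong (λ p → 0 + p * 3) (pos-inc b)) (carry (pos b) (3 ^ trailingOnes b))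
    where
    carry : ∀ x y → 0 + (x + suc y) * 3 ≡ (2 + x * 3) + suc (3 * y)
    carry = solve-∀

  cantor-pos : ∀ b → cantor (pos b) ≡ true
  cantor-pos []          = refl
  cantor-pos (false ∷ b) = trans (cantor-digit 0 (pos b) (s≤s z≤n)) (cantor-pos b)
  cantor-pos (true ∷ b)  = trans (cantor-digit 2 (pos b) (s≤s (s≤s (s≤s z≤n)))) (cantor-pos b)

  cantor-gap : ∀ b d → d < 3 ^ trailingOnes b → cantor (pos b + suc d) ≡ false
  cantor-gap []          zero    _         = refl
  cantor-gap []          (suc d) (s≤s ())
  cantor-gap (false ∷ b) (suc d) (s≤s ())
  cantor-gap (false ∷ b) zero    _         =
    trans (cong cantor (middle-digit (pos b))) (cantor-digit 1 (pos b) (s≤s (s≤s z≤n)))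
    where
    middle-digit : ∀ x → (0 + x * 3) + 1 ≡ 1 + x * 3
    middle-digit = solve-∀
  cantor-gap (true ∷ b)  d       d<3^[1+k] = begin
    cantor ((2 + pos b * 3) + suc d)
      ≡⟨ cong (λ e → cantor ((2 + pos b * 3) + suc e)) (m≡m%n+[m/n]*n d 3) ⟩
    cantor ((2 + pos b * 3) + suc (d % 3 + (d / 3) * 3))
      ≡⟨ cong cantor (regroup (pos b) (d % 3) (d / 3)) ⟩
    cantor (d % 3 + (pos b + suc (d / 3)) * 3)
      ≡⟨ cantor-digit (d % 3) (pos b + suc (d / 3)) (m%n<n d 3) ⟩
    (if d % 3 ≡ᵇ 1 then false else cantor (pos b + suc (d / 3)))
      ≡⟨ cong (if d % 3 ≡ᵇ 1 then false else_) (cantor-gap b (d / 3) d/3<3^k) ⟩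
    (if d % 3 ≡ᵇ 1 then false else false)
      ≡⟨ if-eta (d % 3 ≡ᵇ 1) ⟩
    false ∎
    where
    open ≡-Reasoning
    regroup : ∀ x j e → (2 + x * 3) + suc (j + e * 3) ≡ j + (x + suc e) * 3
    regroup = solve-∀
    d/3<3^k : d / 3 < 3 ^ trailingOnes b
    d/3<3^k = m<n*o⇒m/o<n (<-≤-trans d<3^[1+k] (≤-reflexive (*-comm 3 (3 ^ trailingOnes b))))

  -- The word 0^r 1 0^r₁ 1 ⋯ 1 0^rₖ with run lengths r ∷ r₁ ∷ ⋯ ∷ rₖ.
  mutual
    runsWord : ℕ → List ℕ → List Bool
    runsWord r rs = zeros r ++ afterRun rs

    afterRun : List ℕ → List Bool
    afterRun []       = []
    afterRun (r ∷ rs) = true ∷ runsWord r rs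

  -- The runs following the 1 at position pos b inside a factor: each of them
  -- but the last is a complete gap of c, the last one may be cut short.
  data CounterRuns : List Bool → List ℕ → Set where
    cut  : ∀ {b r} → r ≤ 3 ^ trailingOnes b → CounterRuns b (r ∷ [])
    full : ∀ {b rs} → CounterRuns (inc b) rs → CounterRuns b (3 ^ trailingOnes b ∷ rs)

  -- r zeros of c can immediately precede the 1 at position pos b.
  Leading : List Bool → ℕ → Set
  Leading b r = r ≡ 0 ⊎ ∃ λ b' → b ≡ inc b' × r ≤ 3 ^ trailingOnes b'

  -- Position s lies r steps before the 1 at position pos b.
  Before : ℕ → List Bool → ℕ → Set
  Before s b r = s + r ≡ pos b × Leading b r

  Shape : List Bool → ℕ → List ℕ → Set
  Shape b r rs = rs ≡ [] ⊎ (CounterRuns b rs × Leading b r)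

  window-suc : ∀ s len → window s (suc len) ≡ cantor s ∷ window (suc s) len
  window-suc s len = cong₂ _∷_ (cong cantor (+-identityʳ s))
                               (tabulate-cong (λ k → cong cantor (+-suc s (toℕ k))))

  before-after-one : ∀ {s b} → Before s b 0 → Before (suc s) (inc b) (3 ^ trailingOnes b)
  before-after-one {s} {b} (s+0≡pos , _) = reach , inj₂ (b , refl , ≤-refl)
    where
    reach : suc s + 3 ^ trailingOnes b ≡ pos (inc b)
    reach = begin
      suc s + 3 ^ trailingOnes b   ≡⟨ +-suc s _ ⟨
      s + suc (3 ^ trailingOnes b) ≡⟨ cong (_+ suc (3 ^ trailingOnes b)) (trans (sym (+-identityʳ s)) s+0≡pos) ⟩
      pos b + suc (3 ^ trailingOnes b) ≡⟨ pos-inc b ⟨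
      pos (inc b) ∎
      where open ≡-Reasoning

  before-in-gap : ∀ {s b r} → Before s b (suc r) → Before (suc s) b r
  before-in-gap {s} {r = r} (reach , inj₂ (b' , b≡ , r<gap)) =
    trans (sym (+-suc s r)) reach , inj₂ (b' , b≡ , ≤-trans (n≤1+n r) r<gap)

  cantor-before : ∀ {s b r} → Before s b (suc r) → cantor s ≡ false
  cantor-before {s} {r = r} (reach , inj₂ (b' , refl , r<gap))
    with d , r+d≡gap ← m≤n⇒∃[o]m+o≡n r<gap =
    subst (λ x → cantor x ≡ false) (sym s≡) (cantor-gap b' d d<gap)
    where
    d<gap : d < 3 ^ trailingOnes b'
    d<gap = subst (d <_) r+d≡gap (m<n+m d (s≤s z≤n))
    s≡ : s ≡ pos b' + suc d
    s≡ = +-cancelʳ-≡ (suc r) s _ (begin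
      s + suc r                                    ≡⟨ reach ⟩
      pos (inc b')                                 ≡⟨ pos-inc b' ⟩
      pos b' + suc (3 ^ trailingOnes b')           ≡⟨ cong (λ g → pos b' + suc g) r+d≡gap ⟨
      pos b' + suc (suc r + d)                     ≡⟨ cong (pos b' +_) (cong suc (+-comm (suc r) d)) ⟩
      pos b' + suc (d + suc r)                     ≡⟨ +-assoc (pos b') (suc d) (suc r) ⟨
      pos b' + suc d + suc r                       ∎)
      where open ≡-Reasoning

  before-exists : ∀ s → ∃ λ b → ∃ λ r → Before s b r
  before-exists zero = [] , 0 , refl , inj₁ refl
  before-exists (suc s) with before-exists s
  ... | b , zero  , at-one = inc b , 3 ^ trailingOnes b , before-after-one at-one
  ... | b , suc r , in-gap = b , r , before-in-gap in-gap

  -- How a window ends, relative to the state r zeros before the 1 at pos b: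
  -- either it stops within the first run, or it runs through that 1.
  Ending : List Bool → ℕ → ℕ → List ℕ → Set
  Ending b r r' rs = (rs ≡ [] × r' ≤ r) ⊎ (r' ≡ r × CounterRuns b rs)

  window-runs : ∀ len {s b r} → Before s b r →
                ∃ λ r' → ∃ λ rs → window s len ≡ runsWord r' rs × Ending b r r' rs
  window-runs zero _ = 0 , [] , refl , inj₁ (refl , z≤n)
  window-runs (suc len) {s} {b} {zero} at-one
    with r' , rs , w≡ , ending ← window-runs len (before-after-one at-one) =
    0 , r' ∷ rs , trans (window-suc s len) (cong₂ _∷_ one w≡) , inj₂ (refl , continue ending)
    where
    one : cantor s ≡ true
    one = trans (cong cantor (trans (sym (+-identityʳ s)) (proj₁ at-one))) (cantor-pos b)
    continue : Ending (inc b) (3 ^ trailingOnes b) r' rs → CounterRuns b (r' ∷ rs)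
    continue (inj₁ (refl , r'≤gap)) = cut r'≤gap
    continue (inj₂ (refl , runs))   = full runs
  window-runs (suc len) {s} {b} {suc r} in-gap
    with r' , rs , w≡ , ending ← window-runs len (before-in-gap in-gap) =
    suc r' , rs , trans (window-suc s len) (cong₂ _∷_ (cantor-before in-gap) w≡) , extend ending
    where
    extend : Ending b r r' rs → Ending b (suc r) (suc r') rs
    extend (inj₁ (rs≡ , r'≤r)) = inj₁ (rs≡ , s≤s r'≤r)
    extend (inj₂ (r'≡r , runs)) = inj₂ (cong suc r'≡r , runs)

  decompose : ∀ u → IsFactor u → ∃ λ b → ∃ λ r → ∃ λ rs → u ≡ runsWord r rs × Shape b r rs
  decompose u (s , u≡) with before-exists s
  ... | b , r , before with window-runs (length u) before
  ...   | r' , rs , w≡ , inj₁ (rs≡ , _)     = b , r' , rs , trans u≡ w≡ , inj₁ rs≡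
  ...   | r' , rs , w≡ , inj₂ (refl , runs) = b , r , rs , trans u≡ w≡ , inj₂ (runs , proj₂ before)

  𝟙 : Bool → ℕ
  𝟙 c = if c then 1 else 0

  data RunEnd : List Bool → Set where
    end : RunEnd []
    one : ∀ w → RunEnd (true ∷ w)

  afterRun-end : ∀ rs → RunEnd (afterRun rs)
  afterRun-end []      = end
  afterRun-end (_ ∷ _) = one _

  excess : ℕ → ℕ → List ℕ → ℕ
  excess t r []        = r ∸ t
  excess t r (r' ∷ rs) = r ∸ t + excess t r' rs

  longRuns : ℕ → ℕ → List ℕ → ℕ
  longRuns t r []        = 𝟙 (t <ᵇ r)
  longRuns t r (r' ∷ rs) = 𝟙 (t <ᵇ r) + longRuns t r' rs

  closedRuns : ℕ → ℕ → List ℕ → ℕ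
  closedRuns t r []        = 0
  closedRuns t r (r' ∷ rs) = 𝟙 (t <ᵇ suc r) + closedRuns t r' rs

  leadingExact : ℕ → ℕ → List ℕ → ℕ
  leadingExact t r []      = 0
  leadingExact t r (_ ∷ _) = 𝟙 (t ≡ᵇ r)

  innerExact : ℕ → ℕ → List ℕ → ℕ
  innerExact t r []        = 0
  innerExact t r (r' ∷ rs) = leadingExact t r' rs + innerExact t r' rs

  lastRun : ℕ → List ℕ → ℕ
  lastRun r []        = r
  lastRun r (r' ∷ rs) = lastRun r' rs

  exact+long : ∀ t r → 𝟙 (t ≡ᵇ r) + 𝟙 (t <ᵇ r) ≡ 𝟙 (t <ᵇ suc r)
  exact+long zero    zero    = refl
  exact+long zero    (suc r) = refl
  exact+long (suc t) zero    = refl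
  exact+long (suc t) (suc r) = exact+long t r

  excess-step : ∀ t r → r ∸ t ≡ r ∸ suc t + 𝟙 (t <ᵇ r)
  excess-step zero    zero    = refl
  excess-step zero    (suc r) = +-comm 1 r
  excess-step (suc t) zero    = refl
  excess-step (suc t) (suc r) = excess-step t r

  -- Hence occurrences of 0^(t+1) not extending to 0^(t+2) are the long runs.
  excess-split : ∀ t r rs → excess t r rs ≡ excess (suc t) r rs + longRuns t r rs
  excess-split t r []        = excess-step t r
  excess-split t r (r' ∷ rs) =
    trans (cong₂ _+_ (excess-step t r) (excess-split t r' rs))
          (interchange (r ∸ suc t) (𝟙 (t <ᵇ r)) (excess (suc t) r' rs) (longRuns t r' rs))
    where
    interchange : ∀ a b c d → (a + b) + (c + d) ≡ (a + c) + (b + d)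
    interchange = solve-∀

  -- Runs closed by a 1 and at least t long are the exact ones (leading or
  -- inner) plus the long ones other than a long last run.
  closed-balance : ∀ t r rs →
    closedRuns t r rs + 𝟙 (t <ᵇ lastRun r rs) ≡ leadingExact t r rs + innerExact t r rs + longRuns t r rs
  closed-balance t r []        = refl
  closed-balance t r (r' ∷ rs) = begin
    𝟙 (t <ᵇ suc r) + C + E                              ≡⟨ cong (λ x → x + C + E) (exact+long t r) ⟨
    𝟙 (t ≡ᵇ r) + 𝟙 (t <ᵇ r) + C + E                      ≡⟨ regroup (𝟙 (t ≡ᵇ r)) (𝟙 (t <ᵇ r)) C E ⟩
    𝟙 (t ≡ᵇ r) + 𝟙 (t <ᵇ r) + (C + E)                    ≡⟨ cong (𝟙 (t ≡ᵇ r) + 𝟙 (t <ᵇ r) +_) (closed-balance t r' rs) ⟩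
    𝟙 (t ≡ᵇ r) + 𝟙 (t <ᵇ r) + (Lead + Inner + Long)      ≡⟨ reorder (𝟙 (t ≡ᵇ r)) (𝟙 (t <ᵇ r)) Lead Inner Long ⟩
    𝟙 (t ≡ᵇ r) + (Lead + Inner) + (𝟙 (t <ᵇ r) + Long)    ∎
    where
    open ≡-Reasoning
    C E Lead Inner Long : ℕ
    C     = closedRuns t r' rs
    E     = 𝟙 (t <ᵇ lastRun r' rs)
    Lead  = leadingExact t r' rs
    Inner = innerExact t r' rs
    Long  = longRuns t r' rs
    regroup : ∀ a b c e → a + b + c + e ≡ a + b + (c + e)
    regroup = solve-∀
    reorder : ∀ a b p i l → a + b + (p + i + l) ≡ a + (p + i) + (b + l)
    reorder = solve-∀

  prefix-zeros : ∀ n r {x} → RunEnd x → isPrefix (zeros n) (zeros r ++ x) ≡ (n <ᵇ suc r)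
  prefix-zeros zero    r       _       = refl
  prefix-zeros (suc n) zero    end     = refl
  prefix-zeros (suc n) zero    (one w) = refl
  prefix-zeros (suc n) (suc r) x-end   = prefix-zeros n r x-end

  prefix-zerosOne : ∀ t r w → isPrefix (zeros t ++ [ true ]) (zeros r ++ true ∷ w) ≡ (t ≡ᵇ r)
  prefix-zerosOne zero    zero    w = refl
  prefix-zerosOne zero    (suc r) w = refl
  prefix-zerosOne (suc t) zero    w = refl
  prefix-zerosOne (suc t) (suc r) w = prefix-zerosOne t r w

  prefix-zerosOne-end : ∀ t r → isPrefix (zeros t ++ [ true ]) (zeros r ++ []) ≡ false
  prefix-zerosOne-end zero    zero    = refl
  prefix-zerosOne-end zero    (suc r) = refl
  prefix-zerosOne-end (suc t) zero    = refl
  prefix-zerosOne-end (suc t) (suc r) = prefix-zerosOne-end t r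

  occ-zeros-run : ∀ n r {x} → RunEnd x →
    occ (zeros (suc n)) (zeros r ++ x) ≡ r ∸ n + occ (zeros (suc n)) x
  occ-zeros-run n zero    {x} _     = cong (_+ occ (zeros (suc n)) x) (sym (0∸n≡0 n))
  occ-zeros-run n (suc r) {x} x-end = begin
    𝟙 (isPrefix (zeros n) (zeros r ++ x)) + occ (zeros (suc n)) (zeros r ++ x)
      ≡⟨ cong₂ _+_ (cong 𝟙 (prefix-zeros n r x-end)) (occ-zeros-run n r x-end) ⟩
    𝟙 (n <ᵇ suc r) + (r ∸ n + occ (zeros (suc n)) x)  ≡⟨ +-assoc (𝟙 (n <ᵇ suc r)) _ _ ⟨
    𝟙 (n <ᵇ suc r) + (r ∸ n) + occ (zeros (suc n)) x  ≡⟨ cong (_+ occ (zeros (suc n)) x) run-count ⟩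
    suc r ∸ n + occ (zeros (suc n)) x                  ∎
    where
    open ≡-Reasoning
    run-count : 𝟙 (n <ᵇ suc r) + (r ∸ n) ≡ suc r ∸ n
    run-count = trans (+-comm (𝟙 (n <ᵇ suc r)) (r ∸ n)) (sym (excess-step n (suc r)))

  occ-zerosOne-run : ∀ t r w →
    occ (zeros t ++ [ true ]) (zeros r ++ true ∷ w) ≡ 𝟙 (t <ᵇ suc r) + occ (zeros t ++ [ true ]) w
  occ-zerosOne-run zero    zero    w = refl
  occ-zerosOne-run (suc t) zero    w = refl
  occ-zerosOne-run t       (suc r) w = begin
    𝟙 (isPrefix (zeros t ++ [ true ]) (zeros (suc r) ++ true ∷ w)) + occ z1 (zeros r ++ true ∷ w)
      ≡⟨ cong₂ _+_ (cong 𝟙 (prefix-zerosOne t (suc r) w)) (occ-zerosOne-run t r w) ⟩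
    𝟙 (t ≡ᵇ suc r) + (𝟙 (t <ᵇ suc r) + occ z1 w)  ≡⟨ +-assoc (𝟙 (t ≡ᵇ suc r)) _ _ ⟨
    𝟙 (t ≡ᵇ suc r) + 𝟙 (t <ᵇ suc r) + occ z1 w    ≡⟨ cong (_+ occ z1 w) (exact+long t (suc r)) ⟩
    𝟙 (t <ᵇ suc (suc r)) + occ z1 w               ∎
    where
    open ≡-Reasoning
    z1 : List Bool
    z1 = zeros t ++ [ true ]

  occ-zerosOne-end : ∀ t r → occ (zeros t ++ [ true ]) (zeros r ++ []) ≡ 0
  occ-zerosOne-end t zero    = refl
  occ-zerosOne-end t (suc r) =
    cong₂ _+_ (cong 𝟙 (prefix-zerosOne-end t (suc r))) (occ-zerosOne-end t r)

  occ-one-run : ∀ p r x → occ (true ∷ p) (zeros r ++ x) ≡ occ (true ∷ p) x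
  occ-one-run p zero    x = refl
  occ-one-run p (suc r) x = occ-one-run p r x

  reverse-zeros : ∀ n → reverse (zeros n) ≡ zeros n
  reverse-zeros zero    = refl
  reverse-zeros (suc n) = begin
    reverse (false ∷ zeros n) ≡⟨ unfold-reverse false (zeros n) ⟩
    reverse (zeros n) ∷ʳ false ≡⟨ cong (_∷ʳ false) (reverse-zeros n) ⟩
    zeros n ∷ʳ false          ≡⟨ zeros-snoc n ⟩
    false ∷ zeros n           ∎
    where
    open ≡-Reasoning
    zeros-snoc : ∀ n → zeros n ∷ʳ false ≡ false ∷ zeros n
    zeros-snoc zero    = refl
    zeros-snoc (suc n) = cong (false ∷_) (zeros-snoc n)

  reverse-runsWord : ∀ r rs → ∃ λ y → RunEnd y × reverse (runsWord r rs) ≡ zeros (lastRun r rs) ++ y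
  reverse-runsWord r [] = [] , end , (begin
    reverse (zeros r ++ []) ≡⟨ cong reverse (++-identityʳ (zeros r)) ⟩
    reverse (zeros r)       ≡⟨ reverse-zeros r ⟩
    zeros r                 ≡⟨ ++-identityʳ (zeros r) ⟨
    zeros r ++ []           ∎)
    where open ≡-Reasoning
  reverse-runsWord r (r' ∷ rs) with reverse-runsWord r' rs
  ... | y , y-end , rev≡ = y ++ true ∷ zeros r , append-one y-end , (begin
    reverse (zeros r ++ true ∷ runsWord r' rs)            ≡⟨ reverse-++ (zeros r) _ ⟩
    reverse (true ∷ runsWord r' rs) ++ reverse (zeros r)
      ≡⟨ cong₂ _++_ (unfold-reverse true (runsWord r' rs)) (reverse-zeros r) ⟩
    (reverse (runsWord r' rs) ++ [ true ]) ++ zeros r     ≡⟨ cong (λ v → (v ++ [ true ]) ++ zeros r) rev≡ ⟩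
    ((Z ++ y) ++ [ true ]) ++ zeros r                     ≡⟨ ++-assoc (Z ++ y) [ true ] (zeros r) ⟩
    (Z ++ y) ++ true ∷ zeros r                            ≡⟨ ++-assoc Z y _ ⟩
    Z ++ y ++ true ∷ zeros r                              ∎)
    where
    open ≡-Reasoning
    Z : List Bool
    Z = zeros (lastRun r' rs)
    append-one : ∀ {y} → RunEnd y → RunEnd (y ++ true ∷ zeros r)
    append-one end     = one _
    append-one (one w) = one _

  occ-zeros : ∀ t r rs → occ (zeros (suc t)) (runsWord r rs) ≡ excess t r rs
  occ-zeros t r []        = trans (occ-zeros-run t r end) (+-identityʳ _)
  occ-zeros t r (r' ∷ rs) = trans (occ-zeros-run t r (one _)) (cong (r ∸ t +_) (occ-zeros t r' rs))

  occ-zerosOne : ∀ t r rs → occ (zeros t ++ [ true ]) (runsWord r rs) ≡ closedRuns t r rs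
  occ-zerosOne t r []        = occ-zerosOne-end t r
  occ-zerosOne t r (r' ∷ rs) =
    trans (occ-zerosOne-run t r _) (cong (𝟙 (t <ᵇ suc r) +_) (occ-zerosOne t r' rs))

  P-zerosOne : ∀ t r rs → P (zeros t ++ [ true ]) (runsWord r rs) ≡ leadingExact t r rs
  P-zerosOne t r []       = cong 𝟙 (prefix-zerosOne-end t r)
  P-zerosOne t r (_ ∷ rs) = cong 𝟙 (prefix-zerosOne t r _)

  occ-oneZerosOne : ∀ t r rs → occ (true ∷ zeros t ++ [ true ]) (runsWord r rs) ≡ innerExact t r rs
  occ-oneZerosOne t r []        = occ-one-run _ r []
  occ-oneZerosOne t r (r' ∷ rs) =
    trans (occ-one-run _ r _) (cong₂ _+_ (P-zerosOne t r' rs) (occ-oneZerosOne t r' rs))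

  P-zeros : ∀ t r rs → P (zeros (suc t)) (runsWord r rs) ≡ 𝟙 (t <ᵇ r)
  P-zeros t r rs = cong 𝟙 (prefix-zeros (suc t) r (afterRun-end rs))

  S-zeros : ∀ t r rs → S (zeros (suc t)) (runsWord r rs) ≡ 𝟙 (t <ᵇ lastRun r rs)
  S-zeros t r rs with reverse-runsWord r rs
  ... | y , y-end , rev≡ =
    cong 𝟙 (trans (cong₂ isPrefix (reverse-zeros (suc t)) rev≡) (prefix-zeros (suc t) (lastRun r rs) y-end))

  T-ext : ∀ {a c : Bool} → (T a → T c) → (T c → T a) → a ≡ c
  T-ext {false} {false} _ _ = refl
  T-ext {false} {true}  _ g = ⊥-elim (g _)
  T-ext {true}  {false} f _ = ⊥-elim (f _)
  T-ext {true}  {true}  _ _ = refl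

  module StrictlyIncreasing {f : ℕ → ℕ} (f-mono : ∀ {m n} → m < n → f m < f n) where

    reflects-< : ∀ {m n} → f m < f n → m < n
    reflects-< {m} {n} fm<fn with <-cmp m n
    ... | tri< m<n _ _ = m<n
    ... | tri≈ _ refl _ = ⊥-elim (<-irrefl refl fm<fn)
    ... | tri> _ _ n<m = ⊥-elim (<-asym fm<fn (f-mono n<m))

    injective : ∀ {m n} → f m ≡ f n → m ≡ n
    injective {m} {n} fm≡fn with <-cmp m n
    ... | tri< m<n _ _ = ⊥-elim (<⇒≢ (f-mono m<n) fm≡fn)
    ... | tri≈ _ m≡n _ = m≡n
    ... | tri> _ _ n<m = ⊥-elim (<⇒≢ (f-mono n<m) (sym fm≡fn))

    <ᵇ-image : ∀ m n → (f m <ᵇ f n) ≡ (m <ᵇ n)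
    <ᵇ-image m n = T-ext (λ h → <⇒<ᵇ (reflects-< (<ᵇ⇒< _ _ h))) (λ h → <⇒<ᵇ (f-mono (<ᵇ⇒< m n h)))

    ≡ᵇ-image : ∀ m n → (f m ≡ᵇ f n) ≡ (m ≡ᵇ n)
    ≡ᵇ-image m n = T-ext (λ h → ≡⇒≡ᵇ m n (injective (≡ᵇ⇒≡ _ _ h))) (λ h → ≡⇒≡ᵇ _ _ (cong f (≡ᵇ⇒≡ m n h)))

  open StrictlyIncreasing (^-monoʳ-< 3 (s≤s (s≤s z≤n)))

  bit-inc : ∀ i b → 𝟙 (i ≡ᵇ trailingOnes b) + 𝟙 (bit i b) ≡ 𝟙 (i <ᵇ trailingOnes b) + 𝟙 (bit i (inc b))
  bit-inc zero    []          = refl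
  bit-inc (suc i) []          = refl
  bit-inc zero    (false ∷ b) = refl
  bit-inc (suc i) (false ∷ b) = refl
  bit-inc zero    (true ∷ b)  = refl
  bit-inc (suc i) (true ∷ b)  = bit-inc i b

  bit-trailing : ∀ i b → T (i <ᵇ trailingOnes b) → bit i b ≡ true
  bit-trailing zero    (true ∷ b) _ = refl
  bit-trailing (suc i) (true ∷ b) h = bit-trailing i b h

  bit-cleared : ∀ i b → T (i <ᵇ trailingOnes b) → bit i (inc b) ≡ false
  bit-cleared zero    (true ∷ b) _ = refl
  bit-cleared (suc i) (true ∷ b) h = bit-cleared i b h

  bit-inc-gap : ∀ i b → 𝟙 (3 ^ i ≡ᵇ 3 ^ trailingOnes b) + 𝟙 (bit i b)
                      ≡ 𝟙 (3 ^ i <ᵇ 3 ^ trailingOnes b) + 𝟙 (bit i (inc b))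
  bit-inc-gap i b rewrite ≡ᵇ-image i (trailingOnes b) | <ᵇ-image i (trailingOnes b) = bit-inc i b

  long-exponent : ∀ i k {r} → T (3 ^ i <ᵇ r) → r ≤ 3 ^ k → T (i <ᵇ k)
  long-exponent i k long r≤ = <⇒<ᵇ (reflects-< {i} {k} (<-≤-trans (<ᵇ⇒< _ _ long) r≤))

  lastCounter : List Bool → List ℕ → List Bool
  lastCounter b []       = b
  lastCounter b (_ ∷ rs) = lastCounter (inc b) rs

  -- Along complete gaps bit i is set at every gap of length exactly 3^i and
  -- cleared at every longer one: these events alternate, and their difference
  -- is the change of bit i.
  bit-balance : ∀ i {b r rs} → CounterRuns b (r ∷ rs) →
    let t = 3 ^ i in
    leadingExact t r rs + innerExact t r rs + 𝟙 (bit i b) + 𝟙 (t <ᵇ lastRun r rs)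
      ≡ longRuns t r rs + 𝟙 (bit i (lastCounter b rs))
  bit-balance i {b} {r} (cut _) = +-comm (𝟙 (bit i b)) (𝟙 (3 ^ i <ᵇ r))
  bit-balance i {b} (full {rs = r' ∷ rs} runs) = begin
    Exact + (Lead + Inner) + 𝟙 (bit i b) + Last     ≡⟨ regroup Exact (Lead + Inner) (𝟙 (bit i b)) Last ⟩
    (Exact + 𝟙 (bit i b)) + (Lead + Inner) + Last   ≡⟨ cong (λ x → x + (Lead + Inner) + Last) (bit-inc-gap i b) ⟩
    (Long + 𝟙 (bit i (inc b))) + (Lead + Inner) + Last
      ≡⟨ regroup′ Long (𝟙 (bit i (inc b))) (Lead + Inner) Last ⟩
    Long + (Lead + Inner + 𝟙 (bit i (inc b)) + Last) ≡⟨ cong (Long +_) (bit-balance i runs) ⟩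
    Long + (longRuns t r' rs + 𝟙 (bit i (lastCounter (inc b) rs))) ≡⟨ +-assoc Long _ _ ⟨
    Long + longRuns t r' rs + 𝟙 (bit i (lastCounter (inc b) rs)) ∎
    where
    open ≡-Reasoning
    t Exact Long Lead Inner Last : ℕ
    t     = 3 ^ i
    Exact = 𝟙 (t ≡ᵇ 3 ^ trailingOnes b)
    Long  = 𝟙 (t <ᵇ 3 ^ trailingOnes b)
    Lead  = leadingExact t r' rs
    Inner = innerExact t r' rs
    Last  = 𝟙 (t <ᵇ lastRun r' rs)
    regroup : ∀ e m x l → e + m + x + l ≡ (e + x) + m + l
    regroup = solve-∀
    regroup′ : ∀ g y m l → (g + y) + m + l ≡ g + (m + y + l)
    regroup′ = solve-∀

  last-bit : ∀ i {b r rs} → CounterRuns b (r ∷ rs) → T (3 ^ i <ᵇ lastRun r rs) →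
             bit i (lastCounter b rs) ≡ true
  last-bit i {b} (cut r≤gap) long = bit-trailing i b (long-exponent i (trailingOnes b) long r≤gap)
  last-bit i (full {rs = _ ∷ _} runs) long = last-bit i runs long

  first-bit : ∀ i {b r} → Leading b r → T (3 ^ i <ᵇ r) → bit i b ≡ false
  first-bit i (inj₁ refl) ()
  first-bit i (inj₂ (b' , refl , r≤gap)) long =
    bit-cleared i b' (long-exponent i (trailingOnes b') long r≤gap)

  WithinOne : ℕ → ℕ → Set
  WithinOne m n = m ≡ n ⊎ m ≡ suc n ⊎ n ≡ suc m

  within-one : ∀ m n {x y} → m + x ≡ n + y → x ≤ 1 → y ≤ 1 → WithinOne m n
  within-one m n eq z≤n       z≤n       = inj₁ (+-cancelʳ-≡ 0 m n eq)
  within-one m n eq z≤n       (s≤s z≤n) = inj₂ (inj₁ (trans (sym (+-identityʳ m)) (trans eq (+-comm n 1))))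
  within-one m n eq (s≤s z≤n) z≤n       = inj₂ (inj₂ (trans (sym (+-identityʳ n)) (trans (sym eq) (+-comm m 1))))
  within-one m n eq (s≤s z≤n) (s≤s z≤n) = inj₁ (+-cancelʳ-≡ 1 m n eq)

  𝟙≤1 : ∀ c → 𝟙 c ≤ 1
  𝟙≤1 false = z≤n
  𝟙≤1 true  = s≤s z≤n

  𝟙-exclusive : ∀ {a c} → (T c → a ≡ false) → 𝟙 a + 𝟙 c ≤ 1
  𝟙-exclusive {false} {c}     _ = 𝟙≤1 c
  𝟙-exclusive {true}  {false} _ = s≤s z≤n
  𝟙-exclusive {true}  {true}  h with h _
  ... | ()

  counter-exact-long : ∀ i {b r rs} → CounterRuns b (r ∷ rs) →
    let t = 3 ^ i in
    ∃ λ y → y ≤ 1 × leadingExact t r rs + innerExact t r rs + 𝟙 (bit i b) ≡ longRuns t r rs + y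
  counter-exact-long i {b} {r} {rs} runs with 3 ^ i <ᵇ lastRun r rs in last≡ | bit-balance i runs
  ... | false | balance = 𝟙 (bit i (lastCounter b rs)) , 𝟙≤1 _ , trans (sym (+-identityʳ _)) balance
  ... | true  | balance = 0 , z≤n , +-cancelʳ-≡ 1 _ _ (begin
    leadingExact (3 ^ i) r rs + innerExact (3 ^ i) r rs + 𝟙 (bit i b) + 1 ≡⟨ balance ⟩
    Long + 𝟙 (bit i (lastCounter b rs)) ≡⟨ cong (λ c → Long + 𝟙 c) ends-set ⟩
    Long + 1                            ≡⟨ cong (_+ 1) (+-identityʳ Long) ⟨
    Long + 0 + 1                        ∎)
    where
    open ≡-Reasoning
    Long : ℕ
    Long = longRuns (3 ^ i) r rs
    ends-set : bit i (lastCounter b rs) ≡ true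
    ends-set = last-bit i runs (subst T (sym last≡) _)

  exact-long-within-one : ∀ i {b r rs} → Shape b r rs →
    WithinOne (innerExact (3 ^ i) r rs) (longRuns (3 ^ i) r rs)
  exact-long-within-one i {r = r} {[]} _ with 3 ^ i <ᵇ r
  ... | false = inj₁ refl
  ... | true  = inj₂ (inj₂ refl)
  exact-long-within-one i {rs = _ ∷ _} (inj₁ ())
  exact-long-within-one i {b} {r} {r' ∷ rs} (inj₂ (runs , leading)) with counter-exact-long i runs
  ... | y , y≤1 , balance = within-one Exact (First + Long) shifted (𝟙-exclusive (first-bit i leading)) y≤1
    where
    open ≡-Reasoning
    Exact First Long Bit : ℕ
    Exact = innerExact (3 ^ i) r (r' ∷ rs)
    First = 𝟙 (3 ^ i <ᵇ r)
    Long  = longRuns (3 ^ i) r' rs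
    Bit   = 𝟙 (bit i b)
    shifted : Exact + (Bit + First) ≡ First + Long + y
    shifted = begin
      Exact + (Bit + First) ≡⟨ rotate Exact Bit First ⟩
      First + (Exact + Bit) ≡⟨ cong (First +_) balance ⟩
      First + (Long + y)    ≡⟨ +-assoc First Long y ⟨
      First + Long + y      ∎
      where
      rotate : ∀ e b l → e + (b + l) ≡ l + (e + b)
      rotate = solve-∀

  Balanced : ℕ → ℕ → Set
  Balanced t r = ∃ λ g → r ∸ t ≡ t * g × 3 ∣ₙ 𝟙 (t <ᵇ r) + g

  <ᵇ-false : ∀ {t r} → r ≤ t → (t <ᵇ r) ≡ false
  <ᵇ-false z≤n       = refl
  <ᵇ-false (s≤s r≤t) = <ᵇ-false r≤t

  <ᵇ-true : ∀ {t r} → t < r → (t <ᵇ r) ≡ true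
  <ᵇ-true {zero}  (s≤s _)   = refl
  <ᵇ-true {suc t} (s≤s t<r) = <ᵇ-true t<r

  short-balanced : ∀ t {r} → r ≤ t → Balanced t r
  short-balanced t r≤t =
    0 , trans (m≤n⇒m∸n≡0 r≤t) (sym (*-zeroʳ t)) , subst (λ c → 3 ∣ₙ 𝟙 c + 0) (sym (<ᵇ-false r≤t)) (3 ∣0)

  -- Every gap 3^k of c is balanced for t = 3^i: if k > i it has
  -- 3^i·(3^(k-i) - 1) zeros beyond t, and 1 + (3^(k-i) - 1) = 3^(k-i).
  gap-balanced : ∀ i k → Balanced (3 ^ i) (3 ^ k)
  gap-balanced i k with ≤-<-connex k i
  ... | inj₁ k≤i = short-balanced (3 ^ i) (^-monoʳ-≤ 3 k≤i)
  ... | inj₂ i<k with d , refl ← m≤n⇒∃[o]m+o≡n i<k =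
    3 ^ suc d ∸ 1 , beyond , subst (3 ∣ₙ_) (sym with-indicator) (m∣m*n (3 ^ d))
    where
    open ≡-Reasoning
    beyond : 3 ^ (suc i + d) ∸ 3 ^ i ≡ 3 ^ i * (3 ^ suc d ∸ 1)
    beyond = begin
      3 ^ (suc i + d) ∸ 3 ^ i          ≡⟨ cong (λ e → 3 ^ e ∸ 3 ^ i) (+-suc i d) ⟨
      3 ^ (i + suc d) ∸ 3 ^ i          ≡⟨ cong (_∸ 3 ^ i) (^-distribˡ-+-* 3 i (suc d)) ⟩
      3 ^ i * 3 ^ suc d ∸ 3 ^ i        ≡⟨ cong (3 ^ i * 3 ^ suc d ∸_) (*-identityʳ (3 ^ i)) ⟨
      3 ^ i * 3 ^ suc d ∸ 3 ^ i * 1    ≡⟨ *-distribˡ-∸ (3 ^ i) (3 ^ suc d) 1 ⟨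
      3 ^ i * (3 ^ suc d ∸ 1)          ∎
    with-indicator : 𝟙 (3 ^ i <ᵇ 3 ^ (suc i + d)) + (3 ^ suc d ∸ 1) ≡ 3 * 3 ^ d
    with-indicator rewrite <ᵇ-true (^-monoʳ-< 3 (s≤s (s≤s z≤n)) i<k) = m+[n∸m]≡n (m^n>0 3 (suc d))

  excess-balanced : ∀ t r rs → All (Balanced t) (r ∷ rs) →
    ∃ λ q → excess t r rs ≡ t * q × 3 ∣ₙ longRuns t r rs + q
  excess-balanced t r []        (r-bal ∷ [])   = r-bal
  excess-balanced t r (r' ∷ rs) ((g , r≡ , 3∣g) ∷ rest)
    with q , rest≡ , 3∣q ← excess-balanced t r' rs rest =
    g + q , trans (cong₂ _+_ r≡ rest≡) (sym (*-distribˡ-+ t g q)) ,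
    subst (3 ∣ₙ_) (interchange (𝟙 (t <ᵇ r)) g (longRuns t r' rs) q) (∣m∣n⇒∣m+n 3∣g 3∣q)
    where
    interchange : ∀ a b c d → (a + b) + (c + d) ≡ (a + c) + (b + d)
    interchange = solve-∀

  counter-balanced : ∀ i {b r rs} → CounterRuns b (r ∷ rs) → lastRun r rs ≤ 3 ^ i →
                     All (Balanced (3 ^ i)) (r ∷ rs)
  counter-balanced i (cut _) r≤t = short-balanced (3 ^ i) r≤t ∷ []
  counter-balanced i {b} (full {rs = _ ∷ _} runs) last≤t =
    gap-balanced i (trailingOnes b) ∷ counter-balanced i runs last≤t

  shape-balanced : ∀ i {b r rs} → Shape b r rs → r ≤ 3 ^ i → lastRun r rs ≤ 3 ^ i →
                   All (Balanced (3 ^ i)) (r ∷ rs)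
  shape-balanced i {rs = []}    _                 r≤t _      = short-balanced (3 ^ i) r≤t ∷ []
  shape-balanced i {rs = _ ∷ _} (inj₁ ())
  shape-balanced i {rs = _ ∷ _} (inj₂ (runs , _)) r≤t last≤t =
    short-balanced (3 ^ i) r≤t ∷ counter-balanced i runs last≤t

  not-long-run : ∀ t r → 𝟙 (t <ᵇ r) ≡ 0 → r ≤ t
  not-long-run t       zero    _ = z≤n
  not-long-run zero    (suc r) ()
  not-long-run (suc t) (suc r) h = s≤s (not-long-run t r h)


open Runs
open import Data.Nat as ℕ using ()
open import Data.Nat.Properties using (+-identityʳ)
open import Data.Nat.Divisibility using (divides) renaming (_∣_ to _∣ₙ_)
open import Data.Integer using (ℤ; +_; _+_; _-_; _*_; -_)
open import Data.Integer.Properties using (pos-+; pos-*)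
open import Data.Integer.Divisibility using (_∣_)
import Data.Integer.Divisibility.Signed as Signed
open import Data.Integer.Tactic.RingSolver using (solve-∀)
open import Relation.Nullary using (¬_)

multiple : ∀ {k x} (w : ℤ) → x ≡ w * k → k ∣ x
multiple w eq = Signed.∣⇒∣ᵤ (Signed.divides w eq)

pos-+₃ : ∀ a b c → + (a ℕ.+ b ℕ.+ c) ≡ + a + + b + + c
pos-+₃ a b c = trans (pos-+ (a ℕ.+ b) c) (cong (_+ + c) (pos-+ a b))

Δ-simplify : ∀ M T N L → N ≡ M ℕ.+ L → + M + + T - + N + + 1 ≡ + T - + L + + 1
Δ-simplify M T N L refl =
  trans (cong (λ n → + M + + T - n + + 1) (pos-+ M L)) (cancel (+ M) (+ T) (+ L))
  where
  cancel : ∀ M T L → M + T - (M + L) + + 1 ≡ T - L + + 1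
  cancel = solve-∀

Δ-range : ∀ {T L} → WithinOne T L → let Δ = + T - + L + + 1 in Δ ≡ + 0 ⊎ Δ ≡ + 1 ⊎ Δ ≡ + 2
Δ-range {T} {L} (inj₁ refl)        = inj₂ (inj₁ (equal (+ T)))
  where
  equal : ∀ x → x - x + + 1 ≡ + 1
  equal = solve-∀
Δ-range {T} {L} (inj₂ (inj₁ refl)) = inj₂ (inj₂ (trans (cong (λ x → x - + L + + 1) (pos-+ 1 L)) (above (+ L))))
  where
  above : ∀ x → + 1 + x - x + + 1 ≡ + 2
  above = solve-∀
Δ-range {T} {L} (inj₂ (inj₂ refl)) = inj₁ (trans (cong (λ x → + T - x + + 1) (pos-+ 1 T)) (below (+ T)))
  where
  below : ∀ x → x - (+ 1 + x) + + 1 ≡ + 0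
  below = solve-∀

-- Given a = p + T + L and L + q = 3K, the mod-3 defect is -2(L + q) = -6K.
Δ-mod-3 : ∀ T L a p q → a ≡ p ℕ.+ T ℕ.+ L → 3 ∣ₙ L ℕ.+ q →
          + 3 ∣ (+ T - + L + + 1) - (+ a + + 2 * + q + + 1 - + p)
Δ-mod-3 T L a p q refl (divides K L+q≡3K) = multiple (- (+ 2 * + K)) (begin
  (+ T - + L + + 1) - (+ (p ℕ.+ T ℕ.+ L) + + 2 * + q + + 1 - + p)
    ≡⟨ cong (λ x → (+ T - + L + + 1) - (x + + 2 * + q + + 1 - + p)) (pos-+₃ p T L) ⟩
  (+ T - + L + + 1) - (+ p + + T + + L + + 2 * + q + + 1 - + p)
    ≡⟨ defect (+ T) (+ L) (+ p) (+ q) ⟩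
  - (+ 2 * (+ L + + q))                ≡⟨ cong (λ x → - (+ 2 * x)) (pos-+ L q) ⟨
  - (+ 2 * + (L ℕ.+ q))                ≡⟨ cong (λ x → - (+ 2 * + x)) L+q≡3K ⟩
  - (+ 2 * + (K ℕ.* 3))                ≡⟨ cong (λ x → - (+ 2 * x)) (pos-* K 3) ⟩
  - (+ 2 * (+ K * + 3))                ≡⟨ regroup (+ K) ⟩
  - (+ 2 * + K) * + 3                  ∎)
  where
  open ≡-Reasoning
  defect : ∀ T L p q → (T - L + + 1) - (p + T + L + + 2 * q + + 1 - p) ≡ - (+ 2 * (L + q))
  defect = solve-∀
  regroup : ∀ K → - (+ 2 * (K * + 3)) ≡ - (+ 2 * K) * + 3
  regroup = solve-∀

-- Given a + s = p + T + L, the mod-2 defect is 2(s - L).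
Δ-mod-2 : ∀ T L a p s → a ℕ.+ s ≡ p ℕ.+ T ℕ.+ L →
          + 2 ∣ (+ T - + L + + 1) - (+ a + + 1 - + s - + p)
Δ-mod-2 T L a p s a+s≡ = multiple (+ s - + L) (begin
  (+ T - + L + + 1) - (+ a + + 1 - + s - + p)
    ≡⟨ defect (+ T) (+ L) (+ a) (+ p) (+ s) ⟩
  (+ s - + L) * + 2 - ((+ a + + s) - (+ p + + T + + L))
    ≡⟨ cong (λ x → (+ s - + L) * + 2 - (x - (+ p + + T + + L))) sums ⟩
  (+ s - + L) * + 2 - ((+ p + + T + + L) - (+ p + + T + + L))
    ≡⟨ cancel ((+ s - + L) * + 2) (+ p + + T + + L) ⟩
  (+ s - + L) * + 2 ∎)
  where
  open ≡-Reasoning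
  sums : + a + + s ≡ + p + + T + + L
  sums = trans (sym (pos-+ a s)) (trans (cong +_ a+s≡) (pos-+₃ p T L))
  defect : ∀ T L a p s → (T - L + + 1) - (a + + 1 - s - p) ≡ (s - L) * + 2 - ((a + s) - (p + T + L))
  defect = solve-∀
  cancel : ∀ x y → x - (y - y) ≡ x
  cancel = solve-∀

-- The conclusion of the theorem in terms of the counts
-- M = |u|_{0^(t+2)}, T = |u|_{10^t1}, N = |u|_{0^(t+1)}, a = |u|_{0^t1},
-- p = P(0^t1,u), s = S(0^(t+1),u) and P₀ = P(0^(t+1),u).
Conclusion : (t M T N a p s P₀ : ℕ) → Set
Conclusion t M T N a p s P₀ =
  let Δ = + M + + T - + N + + 1 in
  (Δ ≡ + 0 ⊎ Δ ≡ + 1 ⊎ Δ ≡ + 2)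
  × ((P₀ ≡ 0 × s ≡ 0) → ∃ λ q → (+ N ≡ + t * q) × (+ 3 ∣ (Δ - (+ a + + 2 * q + + 1 - + p))))
  × (¬ (P₀ ≡ 0 × s ≡ 0) → + 2 ∣ (Δ - (+ a + + 1 - + s - + p)))

conclusion : ∀ t M T N a p s P₀ L → N ≡ M ℕ.+ L → a ℕ.+ s ≡ p ℕ.+ T ℕ.+ L → WithinOne T L →
  ((P₀ ≡ 0 × s ≡ 0) → ∃ λ q → N ≡ t ℕ.* q × 3 ∣ₙ L ℕ.+ q) →
  Conclusion t M T N a p s P₀
conclusion t M T N a p s P₀ L N≡ a+s≡ within balanced rewrite Δ-simplify M T N L N≡ =
  Δ-range within , mod-3 , λ _ → Δ-mod-2 T L a p s a+s≡
  where
  mod-3 : (P₀ ≡ 0 × s ≡ 0) →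
          ∃ λ q → (+ N ≡ + t * q) × (+ 3 ∣ (+ T - + L + + 1) - (+ a + + 2 * q + + 1 - + p))
  mod-3 (P₀≡0 , refl) with q , N≡tq , 3∣L+q ← balanced (P₀≡0 , refl) =
    + q , trans (cong +_ N≡tq) (pos-* t q) , Δ-mod-3 T L a p q (trans (sym (+-identityʳ a)) a+s≡) 3∣L+q

runs-conclusion : ∀ i {b r rs} → Shape b r rs →
  let t = 3 ^ i in
  Conclusion t (excess (suc t) r rs) (innerExact t r rs) (excess t r rs) (closedRuns t r rs)
               (leadingExact t r rs) (𝟙 (t ℕ.<ᵇ lastRun r rs)) (𝟙 (t ℕ.<ᵇ r))
runs-conclusion i {b} {r} {rs} shape =
  conclusion t _ _ _ _ _ _ _ (longRuns t r rs)
    (excess-split t r rs) (closed-balance t r rs) (exact-long-within-one i shape) short-ends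
  where
  t : ℕ
  t = 3 ^ i
  short-ends : (𝟙 (t ℕ.<ᵇ r) ≡ 0 × 𝟙 (t ℕ.<ᵇ lastRun r rs) ≡ 0) →
               ∃ λ q → excess t r rs ≡ t ℕ.* q × 3 ∣ₙ longRuns t r rs ℕ.+ q
  short-ends (first , last) =
    excess-balanced t r rs (shape-balanced i shape (not-long-run t r first) (not-long-run t _ last))

lemma3p2 : (i : ℕ) (u : List Bool) → IsFactor u →
    let t = 3 ^ i
        Δ = + occ (zeros (suc (suc t))) u + + occ (true ∷ zeros t ++ [ true ]) u
              - + occ (zeros (suc t)) u + + 1
        a = occ (zeros t ++ [ true ]) u
        N = occ (zeros (suc t)) u
        p = P (zeros t ++ [ true ]) u
        s = S (zeros (suc t)) u
    in (Δ ≡ + 0 ⊎ Δ ≡ + 1 ⊎ Δ ≡ + 2)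
       × ((P (zeros (suc t)) u ≡ 0 × s ≡ 0) →
            ∃ λ q → (+ N ≡ + t * q) × (+ 3 ∣ (Δ - (+ a + + 2 * q + + 1 - + p))))
       × (¬ (P (zeros (suc t)) u ≡ 0 × s ≡ 0) →
            + 2 ∣ (Δ - (+ a + + 1 - + s - + p)))
lemma3p2 i u factor with decompose u factor
... | b , r , rs , refl , shape
  rewrite occ-zeros (suc (3 ^ i)) r rs | occ-oneZerosOne (3 ^ i) r rs | occ-zeros (3 ^ i) r rs
        | occ-zerosOne (3 ^ i) r rs | P-zerosOne (3 ^ i) r rs | S-zeros (3 ^ i) r rs | P-zeros (3 ^ i) r rs
  = runs-conclusion i shape
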